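{- For every $n\ge-1$, $\mathrm{cil}\,\gamma_+[n]=|\mathrm{Cil}\Gamma_+[n]|$; equivalently, $\mathrm{cil}=|\mathrm{Cil}|$.
   Context: Sequences indexed by $\mathbb{N}_+=\{ -1,0,1,\dots\}$. Define $\breve{\mathrm{cil}}\,\gamma_+[j]_m=(j+2)\delta_{j,m}+(j+1)\delta_{j+1,m}$ and $\mathrm{cil}\,\gamma_+[n]=\sum_{j=-1}^{n}\binom{1+n}{1+j}\breve{\mathrm{cil}}\,\gamma_+[j]$ (termwise), and let $\mathrm{cil}$ be the matrix with $(n,m)$ entry $\mathrm{cil}\,\gamma_+[n]_m$. Geometric side: $[n]=\{0<\dots<n\}$ ($n\ge0$), $[-1]=\emptyset$; $\Gamma_+[n]_p$ = strictly increasing maps $[p]\to[n]$. For $\sigma\in\Gamma_+[n]_p$, $\tau\in\Gamma_+[n]_q$, $\sigma\preccurlyeq\tau$ means $|\sigma([p])\cap\tau([q])|\le1$ and $\sigma(i)\le\tau(j)$ for all $i,j$. $\mathrm{Cil}\Gamma_+[n]_m=\{(\sigma,\tau)\in\Gamma_+[n]_p\times\Gamma_+[n]_q:p,q\ge-1,\ p+q=m-1,\ \sigma\preccurlyeq\tau\}$ with faces $d_i(\sigma,\tau)=(d_i\sigma,\tau)$ for $i\le p$, $(\sigma,d_{i-p-1}\tau)$ for $i>p$; this is functorial in $[n]$ by postcomposition, giving $\mathrm{Cil}:\mathbf{\Gamma}_+\to$ augmented semi-simplicial sets. $|\mathrm{Cil}\Gamma_+[n]|=(|\mathrm{Cil}\Gamma_+[n]_m|)_{m\ge-1}$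 and $|\mathrm{Cil}|$ is the matrix with $(n,m)$ entry $|\mathrm{Cil}\Gamma_+[n]_m|$. -}

module Defs where

open import Data.Nat using (ℕ; zero; suc; _+_; _*_; _≡ᵇ_)
open import Data.Nat.Combinatorics using (_C_)
open import Data.Bool using (if_then_else_)
open import Data.Fin using (Fin) renaming (_<_ to _<ᶠ_; _≤_ to _≤ᶠ_)
open import Data.Vec using (Vec; lookup)
open import Data.Product using (Σ; _×_)
open import Relation.Binary.PropositionalEquality using (_≡_)

-- INDEX CONVENTION: the paper indexes by ℕ₊ = {-1,0,1,…}.  We shift every
-- index by one: the natural number N stands for the paper's n = N - 1
-- (so [n] has exactly N elements), and likewise M = m + 1, J = j + 1,
-- P = p + 1, Q = q + 1.

δ : ℕ → ℕ → ℕ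
δ a b = if a ≡ᵇ b then 1 else 0

-- cil-breve γ₊[j]_m = (j+2) δ_{j,m} + (j+1) δ_{j+1,m},  with J = j+1, M = m+1
cilBreve : ℕ → ℕ → ℕ
cilBreve J M = suc J * δ J M + J * δ (suc J) M

sumTo : ℕ → (ℕ → ℕ) → ℕ
sumTo zero    f = f zero
sumTo (suc k) f = sumTo k f + f (suc k)

-- cil γ₊[n]_m = Σ_{j=-1}^{n} C(1+n,1+j) · cil-breve γ₊[j]_m,  N = n+1, M = m+1
cil : ℕ → ℕ → ℕ
cil N M = sumTo N (λ J → (N C J) * cilBreve J M)

-- Γ₊[n]_p : strictly increasing maps [p] → [n]; here the source has P = p+1
-- elements and the target N = n+1 elements; a map is given by its table
-- of values (lookup).
record Γ₊ (N P : ℕ) : Set where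
  constructor mkΓ
  field
    val  : Vec (Fin N) P
    .incr : ∀ (i j : Fin P) → i <ᶠ j → lookup val i <ᶠ lookup val j
open Γ₊ public

_∈Im_ : ∀ {N P} → Fin N → Γ₊ N P → Set
x ∈Im σ = Σ (Fin _) (λ i → lookup (val σ) i ≡ x)

_≼_ : ∀ {N P Q} → Γ₊ N P → Γ₊ N Q → Set
_≼_ {N} {P} {Q} σ τ =
  (∀ (x y : Fin N) → x ∈Im σ → x ∈Im τ → y ∈Im σ → y ∈Im τ → x ≡ y)
  × (∀ (i : Fin P) (j : Fin Q) → lookup (val σ) i ≤ᶠ lookup (val τ) j)

-- Cil Γ₊[n]_m = { (σ,τ) ∈ Γ₊[n]_p × Γ₊[n]_q : p + q = m - 1, σ ≼ τ }
-- (p + q = m - 1  ⇔  P + Q = M).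
record Cil (N M : ℕ) : Set where
  constructor mkCil
  field
    P Q : ℕ
    .sum : P + Q ≡ M
    σ   : Γ₊ N P
    τ   : Γ₊ N Q
    .rel : σ ≼ τ

module Submission where

open import Defs
open import Data.Nat using (ℕ; zero; suc; _+_; _*_; _≤_; _<_; z≤n; s≤s)
open import Data.Nat.Properties
  using (+-comm; +-commutativeSemigroup; +-identityʳ; *-suc; *-zeroʳ; *-identityʳ; *-assoc; *-distribˡ-+;
         <⇒≢; >⇒≢; <-trans; n<1+n; ≤-pred; ≤-trans; m≤n⇒m<n∨m≡n; _≤?_; ≰⇒>; _≟_; ≡-irrelevant;
         suc-injective; 0≢1+n)
open import Data.Nat.Combinatorics using (_C_; nCk+nC[k+1]≡[n+1]C[k+1]; k>n⇒nCk≡0)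
open import Data.Nat.Solver using (module +-*-Solver)
open import Algebra.Properties.CommutativeSemigroup +-commutativeSemigroup using () renaming (interchange to +-interchange)
open import Data.Fin using (Fin; zero; suc; toℕ) renaming (_<_ to _<ᶠ_; _≤_ to _≤ᶠ_)
import Data.Fin.Properties as Fin
open import Data.Vec using (Vec; []; _∷_; lookup; map)
open import Data.Vec.Properties using (lookup-map)
open import Data.Product using (_,_; proj₂)
open import Data.Sum using (_⊎_; inj₁; inj₂)
open import Data.Sum.Function.Propositional using (_⊎-↔_)
open import Data.Empty using (⊥; ⊥-elim-irr)
open import Function using (_∘_)
open import Function.Bundles using (_↔_; mk↔ₛ′)
open import Function.Properties.Inverse using (↔-trans; ↔-sym)
open import Function.Related.Propositional using (module EquationalReasoning)
open import Relation.Binary.PropositionalEquality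
open import Relation.Nullary using (yes; no; contradiction)
open import Relation.Nullary.Decidable using (recompute)

open +-*-Solver using (solve; _:+_; _:*_; _:=_; con)

-- In the shifted indices of Defs (N vertices, M = m + 1), deleting the vertex 0 sorts the
-- pairs σ ≼ τ in Cil (N + 1) M into four kinds: 0 is used by neither simplex; 0 = σ(0), and
-- the rest is a pair in Cil N (M - 1); σ is empty and 0 = τ(0); or σ = {0} = τ(0).  As σ lies
-- pointwise below τ, a vertex 0 in τ leaves σ no other choice.  So the counts obey
--   c(N + 1, M) = c(N, M) + c(N, M - 1) + C(N, M - 1) + C(N, M - 2),
-- and by Pascal's rule (M + 1)·C(N, M) + (M - 1)·C(N, M - 1) solves it; the Kronecker deltas
-- in the sum defining cil collapse to the same closed form.  Splitting at 0 in the same way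
-- gives |Γ₊ N P| = C(N, P).

below : (ℕ → ℕ) → ℕ → ℕ
below f zero    = 0
below f (suc M) = f M

Below : (ℕ → Set) → ℕ → Set
Below F zero    = ⊥
Below F (suc M) = F M

pascal : ∀ N K → suc N C K ≡ N C K + below (N C_) K
pascal N zero    = refl
pascal N (suc K) = trans (sym (nCk+nC[k+1]≡[n+1]C[k+1] N K)) (+-comm (N C K) (N C suc K))

cilClosed : ℕ → ℕ → ℕ
cilClosed N M = (N C M) * suc M + below (λ K → (N C K) * K) M

sumTo-cong : ∀ L {f g : ℕ → ℕ} → (∀ J → f J ≡ g J) → sumTo L f ≡ sumTo L g
sumTo-cong zero    f≗g = f≗g zero
sumTo-cong (suc L) f≗g = cong₂ _+_ (sumTo-cong L f≗g) (f≗g (suc L))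

sumTo-+ : ∀ L (f g : ℕ → ℕ) → sumTo L (λ J → f J + g J) ≡ sumTo L f + sumTo L g
sumTo-+ zero    f g = refl
sumTo-+ (suc L) f g = begin
  sumTo L (λ J → f J + g J) + (f (suc L) + g (suc L))
    ≡⟨ cong (_+ (f (suc L) + g (suc L))) (sumTo-+ L f g) ⟩
  (sumTo L f + sumTo L g) + (f (suc L) + g (suc L))
    ≡⟨ +-interchange (sumTo L f) (sumTo L g) (f (suc L)) (g (suc L)) ⟩
  (sumTo L f + f (suc L)) + (sumTo L g + g (suc L)) ∎
  where open ≡-Reasoning

sumTo-zero : ∀ L → sumTo L (λ _ → 0) ≡ 0
sumTo-zero zero    = refl
sumTo-zero (suc L) = cong (_+ 0) (sumTo-zero L)

δ-refl : ∀ a → δ a a ≡ 1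
δ-refl zero    = refl
δ-refl (suc a) = δ-refl a

δ-≢ : ∀ {a b} → a ≢ b → δ a b ≡ 0
δ-≢ {zero}  {zero}  a≢b = contradiction refl a≢b
δ-≢ {zero}  {suc b} a≢b = refl
δ-≢ {suc a} {zero}  a≢b = refl
δ-≢ {suc a} {suc b} a≢b = δ-≢ (a≢b ∘ cong suc)

*-δ-refl : ∀ x a → x * δ a a ≡ x
*-δ-refl x a = trans (cong (x *_) (δ-refl a)) (*-identityʳ x)

*-δ-≢ : ∀ x {a b} → a ≢ b → x * δ a b ≡ 0
*-δ-≢ x a≢b = trans (cong (x *_) (δ-≢ a≢b)) (*-zeroʳ x)

sumTo-δ-> : ∀ L (g : ℕ → ℕ) {M} → L < M → sumTo L (λ J → g J * δ J M) ≡ 0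
sumTo-δ-> zero    g L<M = *-δ-≢ (g 0) (<⇒≢ L<M)
sumTo-δ-> (suc L) g L<M =
  cong₂ _+_ (sumTo-δ-> L g (<-trans (n<1+n L) L<M)) (*-δ-≢ (g (suc L)) (<⇒≢ L<M))

sumTo-δ-≤ : ∀ L (g : ℕ → ℕ) {M} → M ≤ L → sumTo L (λ J → g J * δ J M) ≡ g M
sumTo-δ-≤ zero    g z≤n = *-identityʳ (g 0)
sumTo-δ-≤ (suc L) g {M} M≤1+L with m≤n⇒m<n∨m≡n M≤1+L
... | inj₁ M<1+L = trans (cong₂ _+_ (sumTo-δ-≤ L g (≤-pred M<1+L)) (*-δ-≢ (g (suc L)) (>⇒≢ M<1+L)))
                         (+-identityʳ (g M))
... | inj₂ refl  = cong₂ _+_ (sumTo-δ-> L g (n<1+n L)) (*-δ-refl (g (suc L)) (suc L))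

sumTo-δ : ∀ L (g : ℕ → ℕ) M → (∀ J → L < J → g J ≡ 0) → sumTo L (λ J → g J * δ J M) ≡ g M
sumTo-δ L g M g-vanishes with M ≤? L
... | yes M≤L = sumTo-δ-≤ L g M≤L
... | no  M≰L = trans (sumTo-δ-> L g (≰⇒> M≰L)) (sym (g-vanishes M (≰⇒> M≰L)))

sumTo-δ-suc : ∀ L (g : ℕ → ℕ) M → (∀ J → L < J → g J ≡ 0) →
              sumTo L (λ J → g J * δ (suc J) M) ≡ below g M
sumTo-δ-suc L g zero    _          = trans (sumTo-cong L (λ J → *-zeroʳ (g J))) (sumTo-zero L)
sumTo-δ-suc L g (suc M) g-vanishes = sumTo-δ L g M g-vanishes

C-*-vanishes : ∀ N (h : ℕ → ℕ) J → N < J → (N C J) * h J ≡ 0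
C-*-vanishes N h J N<J = cong (_* h J) (k>n⇒nCk≡0 N<J)

cil≡cilClosed : ∀ N M → cil N M ≡ cilClosed N M
cil≡cilClosed N M = begin
  sumTo N (λ J → (N C J) * cilBreve J M)
    ≡⟨ sumTo-cong N (λ J → *-distribˡ-+ (N C J) (suc J * δ J M) (J * δ (suc J) M)) ⟩
  sumTo N (λ J → (N C J) * (suc J * δ J M) + (N C J) * (J * δ (suc J) M))
    ≡⟨ sumTo-+ N _ _ ⟩
  sumTo N (λ J → (N C J) * (suc J * δ J M)) + sumTo N (λ J → (N C J) * (J * δ (suc J) M))
    ≡⟨ cong₂ _+_ (sumTo-cong N (λ J → sym (*-assoc (N C J) (suc J) _)))
                 (sumTo-cong N (λ J → sym (*-assoc (N C J) J _))) ⟩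
  sumTo N (λ J → (N C J) * suc J * δ J M) + sumTo N (λ J → (N C J) * J * δ (suc J) M)
    ≡⟨ cong₂ _+_ (sumTo-δ N _ M (C-*-vanishes N suc)) (sumTo-δ-suc N _ M (C-*-vanishes N (λ J → J))) ⟩
  cilClosed N M ∎
  where open ≡-Reasoning

below-*-index : ∀ f M → below (λ K → f K * K) M + below f M ≡ below f M * M
below-*-index f zero    = refl
below-*-index f (suc M) = trans (+-comm (f M * M) (f M)) (sym (*-suc (f M) M))

cilClosed-suc : ∀ N M → cilClosed (suc N) M ≡
  cilClosed N M + (below (cilClosed N) M + (below (N C_) M + below (below (N C_)) M))
cilClosed-suc N zero    = refl
cilClosed-suc N (suc M) = begin
  (suc N C suc M) * (2 + M) + (suc N C M) * M
    ≡⟨ cong₂ (λ x y → x * (2 + M) + y * M) (pascal N (suc M)) (pascal N M) ⟩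
  (b + a) * (2 + M) + (a + c) * M
    ≡⟨ solve 4 (λ a b c m → (b :+ a) :* (con 2 :+ m) :+ (a :+ c) :* m
                := ((b :* (con 2 :+ m) :+ a :* m) :+ (a :* (con 1 :+ m) :+ a)) :+ c :* m) refl a b c M ⟩
  (b * (2 + M) + a * M) + (a * (1 + M) + a) + c * M
    ≡⟨ cong ((b * (2 + M) + a * M) + (a * (1 + M) + a) +_) (sym (below-*-index (N C_) M)) ⟩
  (b * (2 + M) + a * M) + (a * (1 + M) + a) + (d + c)
    ≡⟨ solve 5 (λ a b c d m → ((b :* (con 2 :+ m) :+ a :* m) :+ (a :* (con 1 :+ m) :+ a)) :+ (d :+ c)
                := (b :* (con 2 :+ m) :+ a :* m) :+ ((a :* (con 1 :+ m) :+ d) :+ (a :+ c))) refl a b c d M ⟩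
  (b * (2 + M) + a * M) + ((a * (1 + M) + d) + (a + c)) ∎
  where
  open ≡-Reasoning
  a = N C M
  b = N C suc M
  c = below (N C_) M
  d = below (λ K → (N C K) * K) M

Increasing : ∀ {N P} → Vec (Fin N) P → Set
Increasing v = ∀ i j → i <ᶠ j → lookup v i <ᶠ lookup v j

_⊑_ : ∀ {N P Q} → Γ₊ N P → Γ₊ N Q → Set
σ ⊑ τ = ∀ i j → lookup (val σ) i ≤ᶠ lookup (val τ) j

⊑⇒≼ : ∀ {N P Q} (σ : Γ₊ N P) (τ : Γ₊ N Q) → σ ⊑ τ → σ ≼ τ
⊑⇒≼ σ τ σ⊑τ = at-most-one-common , σ⊑τ
  where
  at-most-one-common : ∀ x y → x ∈Im σ → x ∈Im τ → y ∈Im σ → y ∈Im τ → x ≡ y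
  at-most-one-common x y (i , σi≡x) (j , τj≡x) (k , σk≡y) (l , τl≡y) =
    Fin.≤-antisym (subst₂ _≤ᶠ_ σi≡x τl≡y (σ⊑τ i l)) (subst₂ _≤ᶠ_ σk≡y τj≡x (σ⊑τ k j))

Γ₊-≡ : ∀ {N P} {σ τ : Γ₊ N P} → val σ ≡ val τ → σ ≡ τ
Γ₊-≡ refl = refl

empty : ∀ {N} → Γ₊ N 0
empty = mkΓ [] (λ ())

map-suc-increasing : ∀ {N P} {v : Vec (Fin N) P} → Increasing v → Increasing (map suc v)
map-suc-increasing {v = v} inc i j i<j =
  subst₂ _<ᶠ_ (sym (lookup-map i suc v)) (sym (lookup-map j suc v)) (s≤s (inc i j i<j))

shift : ∀ {N P} → Γ₊ N P → Γ₊ (suc N) P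
shift (mkΓ v inc) = mkΓ (map suc v) (map-suc-increasing {v = v} inc)

zero∷map-suc-increasing : ∀ {N P} {v : Vec (Fin N) P} → Increasing v → Increasing (zero ∷ map suc v)
zero∷map-suc-increasing {v = v} inc zero    (suc j) _         =
  subst (λ y → 0 < toℕ y) (sym (lookup-map j suc v)) (s≤s z≤n)
zero∷map-suc-increasing {v = v} inc (suc i) (suc j) (s≤s i<j) = map-suc-increasing {v = v} inc i j i<j

cone : ∀ {N P} → Γ₊ N P → Γ₊ (suc N) (suc P)
cone (mkΓ v inc) = mkΓ (zero ∷ map suc v) (zero∷map-suc-increasing {v = v} inc)

1+n≤0-elim : ∀ {n} {A : Set} → .(suc n ≤ 0) → A
1+n≤0-elim ()

Positive : ∀ {N P} → Vec (Fin (suc N)) P → Set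
Positive v = ∀ i → 0 < toℕ (lookup v i)

unshift : ∀ {N P} (v : Vec (Fin (suc N)) P) → .(Positive v) → Vec (Fin N) P
unshift []          pos = []
unshift (zero  ∷ v) pos = 1+n≤0-elim (pos zero)
unshift (suc x ∷ v) pos = x ∷ unshift v (pos ∘ suc)

map-suc-unshift : ∀ {N P} (v : Vec (Fin (suc N)) P) .(pos : Positive v) → map suc (unshift v pos) ≡ v
map-suc-unshift []          pos = refl
map-suc-unshift (zero  ∷ v) pos = 1+n≤0-elim (pos zero)
map-suc-unshift (suc x ∷ v) pos = cong (suc x ∷_) (map-suc-unshift v (pos ∘ suc))

unshift-map-suc : ∀ {N P} (w : Vec (Fin N) P) .(pos : Positive (map suc w)) → unshift (map suc w) pos ≡ w
unshift-map-suc []      pos = refl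
unshift-map-suc (x ∷ w) pos = cong (x ∷_) (unshift-map-suc w (pos ∘ suc))

lookup-unshift : ∀ {N P} (v : Vec (Fin (suc N)) P) .(pos : Positive v) i →
                 suc (lookup (unshift v pos) i) ≡ lookup v i
lookup-unshift v pos i = trans (sym (lookup-map i suc (unshift v pos))) (cong (λ w → lookup w i) (map-suc-unshift v pos))

unshift-increasing : ∀ {N P} {v : Vec (Fin (suc N)) P} .(pos : Positive v) → Increasing v → Increasing (unshift v pos)
unshift-increasing {v = v} pos inc i j i<j =
  ≤-pred (subst₂ _<ᶠ_ (sym (lookup-unshift v pos i)) (sym (lookup-unshift v pos j)) (inc i j i<j))

unshiftΓ : ∀ {N P} (σ : Γ₊ (suc N) P) → .(Positive (val σ)) → Γ₊ N P
unshiftΓ (mkΓ v inc) pos = mkΓ (unshift v pos) (unshift-increasing {v = v} pos inc)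

tail-increasing : ∀ {N P} {x : Fin N} {v : Vec (Fin N) P} → Increasing (x ∷ v) → Increasing v
tail-increasing inc i j i<j = inc (suc i) (suc j) (s≤s i<j)

zero∷-tail-positive : ∀ {N P} {v : Vec (Fin (suc N)) P} → Increasing (zero ∷ v) → Positive v
zero∷-tail-positive inc i = inc zero (suc i) (s≤s z≤n)

suc∷-positive : ∀ {N P} {x : Fin N} {v : Vec (Fin (suc N)) P} → Increasing (suc x ∷ v) → Positive (suc x ∷ v)
suc∷-positive inc zero    = s≤s z≤n
suc∷-positive inc (suc i) = ≤-trans (s≤s z≤n) (inc zero (suc i) (s≤s z≤n))

split0 : ∀ {N P} → Γ₊ (suc N) P → Γ₊ N P ⊎ Below (Γ₊ N) P
split0 (mkΓ []          inc) = inj₁ empty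
split0 (mkΓ (zero ∷ v)  inc) = inj₂ (unshiftΓ (mkΓ v (tail-increasing inc)) (zero∷-tail-positive inc))
split0 (mkΓ (suc x ∷ v) inc) = inj₁ (unshiftΓ (mkΓ (suc x ∷ v) inc) (suc∷-positive inc))

join0 : ∀ {N P} → Γ₊ N P ⊎ Below (Γ₊ N) P → Γ₊ (suc N) P
join0             (inj₁ σ) = shift σ
join0 {P = suc P} (inj₂ σ) = cone σ

join0-split0 : ∀ {N P} (σ : Γ₊ (suc N) P) → join0 (split0 σ) ≡ σ
join0-split0 (mkΓ []          inc) = refl
join0-split0 (mkΓ (zero ∷ v)  inc) = Γ₊-≡ (cong (zero ∷_) (map-suc-unshift v _))
join0-split0 (mkΓ (suc x ∷ v) inc) = Γ₊-≡ (map-suc-unshift (suc x ∷ v) (suc∷-positive inc))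

split0-join0 : ∀ {N P} (σ : Γ₊ N P ⊎ Below (Γ₊ N) P) → split0 (join0 σ) ≡ σ
split0-join0             (inj₁ (mkΓ []      inc)) = refl
split0-join0             (inj₁ (mkΓ (x ∷ v) inc)) = cong inj₁ (Γ₊-≡ (cong (x ∷_) (unshift-map-suc v _)))
split0-join0 {P = suc P} (inj₂ (mkΓ v inc))       = cong inj₂ (Γ₊-≡ (unshift-map-suc v _))

Γ₊-suc↔ : ∀ {N P} → Γ₊ (suc N) P ↔ (Γ₊ N P ⊎ Below (Γ₊ N) P)
Γ₊-suc↔ = mk↔ₛ′ split0 join0 split0-join0 join0-split0

shift-mono-⊑ : ∀ {N P Q} (σ : Γ₊ N P) (τ : Γ₊ N Q) → σ ⊑ τ → shift σ ⊑ shift τ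
shift-mono-⊑ σ τ σ⊑τ i j =
  subst₂ _≤ᶠ_ (sym (lookup-map i suc (val σ))) (sym (lookup-map j suc (val τ))) (s≤s (σ⊑τ i j))

shift-cancel-⊑ : ∀ {N P Q} (σ : Γ₊ N P) (τ : Γ₊ N Q) → shift σ ⊑ shift τ → σ ⊑ τ
shift-cancel-⊑ σ τ sσ⊑sτ i j =
  ≤-pred (subst₂ _≤ᶠ_ (lookup-map i suc (val σ)) (lookup-map j suc (val τ)) (sσ⊑sτ i j))

cone-⊑-shift : ∀ {N P Q} (σ : Γ₊ N P) (τ : Γ₊ N Q) → σ ⊑ τ → cone σ ⊑ shift τ
cone-⊑-shift σ τ σ⊑τ zero    j = z≤n
cone-⊑-shift σ τ σ⊑τ (suc i) j = shift-mono-⊑ σ τ σ⊑τ i j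

record SplitCil (N M : ℕ) : Set where
  constructor mkSplitCil
  field
    P Q      : ℕ
    sum      : P + Q ≡ M
    σ        : Γ₊ N P ⊎ Below (Γ₊ N) P
    τ        : Γ₊ N Q ⊎ Below (Γ₊ N) Q
    .ordered : join0 σ ⊑ join0 τ

Cil-≡ : ∀ {N M P Q} {σ σ′ : Γ₊ N P} {τ τ′ : Γ₊ N Q} .{s s′ r r′} → σ ≡ σ′ → τ ≡ τ′ →
        mkCil {N} {M} P Q s σ τ r ≡ mkCil P Q s′ σ′ τ′ r′
Cil-≡ refl refl = refl

SplitCil-≡ : ∀ {N M P Q} {σ σ′ : Γ₊ N P ⊎ Below (Γ₊ N) P} {τ τ′ : Γ₊ N Q ⊎ Below (Γ₊ N) Q}
               {s s′ : P + Q ≡ M} .{o o′} → σ ≡ σ′ → τ ≡ τ′ →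
             mkSplitCil P Q s σ τ o ≡ mkSplitCil P Q s′ σ′ τ′ o′
SplitCil-≡ {s = s} {s′} refl refl rewrite ≡-irrelevant s s′ = refl

Cil-suc↔SplitCil : ∀ {N M} → Cil (suc N) M ↔ SplitCil N M
Cil-suc↔SplitCil {N} {M} = mk↔ₛ′ to from to∘from from∘to
  where
  to : Cil (suc N) M → SplitCil N M
  to (mkCil P Q s σ τ r) = mkSplitCil P Q (recompute (P + Q ≟ M) s) (split0 σ) (split0 τ)
    (subst₂ _⊑_ (sym (join0-split0 σ)) (sym (join0-split0 τ)) (proj₂ r))
  from : SplitCil N M → Cil (suc N) M
  from (mkSplitCil P Q s σ τ o) = mkCil P Q s (join0 σ) (join0 τ) (⊑⇒≼ (join0 σ) (join0 τ) o)
  to∘from : ∀ c → to (from c) ≡ c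
  to∘from (mkSplitCil P Q s σ τ o) = SplitCil-≡ (split0-join0 σ) (split0-join0 τ)
  from∘to : ∀ c → from (to c) ≡ c
  from∘to (mkCil P Q s σ τ r) = Cil-≡ (join0-split0 σ) (join0-split0 τ)

-- A vertex 0 of τ forces σ ⊆ {0}, since σ lies pointwise below τ; this rules out the remaining cases.
SplitCil↔⊎ : ∀ {N M} → SplitCil N M ↔ (Cil N M ⊎ Below (Cil N) M ⊎ Below (Γ₊ N) M ⊎ Below (Below (Γ₊ N)) M)
SplitCil↔⊎ {N} {M} = mk↔ₛ′ to from to∘from from∘to
  where
  to : ∀ {M} → SplitCil N M → Cil N M ⊎ Below (Cil N) M ⊎ Below (Γ₊ N) M ⊎ Below (Below (Γ₊ N)) M
  to (mkSplitCil P Q s (inj₁ σ) (inj₁ τ) o) = inj₁ (mkCil P Q s σ τ (⊑⇒≼ σ τ (shift-cancel-⊑ σ τ o)))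
  to {suc M} (mkSplitCil (suc P) Q s (inj₂ σ) (inj₁ τ) o) =
    inj₂ (inj₁ (mkCil P Q (suc-injective s) σ τ (⊑⇒≼ σ τ (shift-cancel-⊑ σ τ (λ i → o (suc i))))))
  to (mkSplitCil zero (suc Q) refl (inj₁ (mkΓ [] _)) (inj₂ τ) o) = inj₂ (inj₂ (inj₁ τ))
  to (mkSplitCil (suc P) (suc Q) s (inj₁ (mkΓ (x ∷ _) _)) (inj₂ τ) o) = 1+n≤0-elim (o zero zero)
  to (mkSplitCil (suc zero) (suc Q) refl (inj₂ (mkΓ [] _)) (inj₂ τ) o) = inj₂ (inj₂ (inj₂ τ))
  to (mkSplitCil (suc (suc P)) (suc Q) s (inj₂ (mkΓ (x ∷ _) _)) (inj₂ τ) o) = 1+n≤0-elim (o (suc zero) zero)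
  from : ∀ {M} → Cil N M ⊎ Below (Cil N) M ⊎ Below (Γ₊ N) M ⊎ Below (Below (Γ₊ N)) M → SplitCil N M
  from {M} (inj₁ (mkCil P Q s σ τ r)) =
    mkSplitCil P Q (recompute (P + Q ≟ M) s) (inj₁ σ) (inj₁ τ) (shift-mono-⊑ σ τ (proj₂ r))
  from {suc M} (inj₂ (inj₁ (mkCil P Q s σ τ r))) =
    mkSplitCil (suc P) Q (cong suc (recompute (P + Q ≟ M) s)) (inj₂ σ) (inj₁ τ) (cone-⊑-shift σ τ (proj₂ r))
  from {suc M} (inj₂ (inj₂ (inj₁ τ))) = mkSplitCil 0 (suc M) refl (inj₁ empty) (inj₂ τ) (λ ())
  from {suc (suc M)} (inj₂ (inj₂ (inj₂ τ))) = mkSplitCil 1 (suc M) refl (inj₂ empty) (inj₂ τ) λ { zero j → z≤n }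
  to∘from : ∀ {M} c → to {M} (from c) ≡ c
  to∘from               (inj₁ _)               = refl
  to∘from {suc M}       (inj₂ (inj₁ _))        = refl
  to∘from {suc M}       (inj₂ (inj₂ (inj₁ _))) = refl
  to∘from {suc (suc M)} (inj₂ (inj₂ (inj₂ _))) = refl
  from∘to : ∀ {M} c → from {M} (to c) ≡ c
  from∘to (mkSplitCil P Q s (inj₁ σ) (inj₁ τ) o) = SplitCil-≡ refl refl
  from∘to {suc M} (mkSplitCil (suc P) Q s (inj₂ σ) (inj₁ τ) o) = SplitCil-≡ refl refl
  from∘to (mkSplitCil zero (suc Q) refl (inj₁ (mkΓ [] _)) (inj₂ τ) o) = refl
  from∘to (mkSplitCil (suc P) (suc Q) s (inj₁ (mkΓ (x ∷ _) _)) (inj₂ τ) o) = 1+n≤0-elim (o zero zero)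
  from∘to (mkSplitCil (suc zero) (suc Q) refl (inj₂ (mkΓ [] _)) (inj₂ τ) o) = refl
  from∘to (mkSplitCil (suc (suc P)) (suc Q) s (inj₂ (mkΓ (x ∷ _) _)) (inj₂ τ) o) = 1+n≤0-elim (o (suc zero) zero)

below-↔ : ∀ {F : ℕ → Set} {f : ℕ → ℕ} → (∀ M → F M ↔ Fin (f M)) → ∀ M → Below F M ↔ Fin (below f M)
below-↔ F↔f zero    = ↔-sym Fin.0↔⊥
below-↔ F↔f (suc M) = F↔f M

infixr 1 _⊎-↔Fin_
_⊎-↔Fin_ : ∀ {A B : Set} {m n} → A ↔ Fin m → B ↔ Fin n → (A ⊎ B) ↔ Fin (m + n)
A↔m ⊎-↔Fin B↔n = ↔-trans (A↔m ⊎-↔ B↔n) (↔-sym Fin.+↔⊎)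

Γ₊↔Fin : ∀ N P → Γ₊ N P ↔ Fin (N C P)
Γ₊↔Fin zero    zero    = mk↔ₛ′ (λ _ → zero) (λ _ → empty) (λ { zero → refl }) (λ { (mkΓ [] _) → refl })
Γ₊↔Fin zero    (suc P) = mk↔ₛ′ (λ { (mkΓ (() ∷ _) _) }) (λ ()) (λ ()) (λ { (mkΓ (() ∷ _) _) })
Γ₊↔Fin (suc N) P = begin
  Γ₊ (suc N) P                   ↔⟨ Γ₊-suc↔ ⟩
  (Γ₊ N P ⊎ Below (Γ₊ N) P)       ↔⟨ Γ₊↔Fin N P ⊎-↔Fin below-↔ (Γ₊↔Fin N) P ⟩
  Fin (N C P + below (N C_) P)    ≡⟨ cong Fin (sym (pascal N P)) ⟩
  Fin (suc N C P)                 ∎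
  where open EquationalReasoning

cilClosed-zero-suc : ∀ M → cilClosed 0 (suc M) ≡ 0
cilClosed-zero-suc zero    = refl
cilClosed-zero-suc (suc M) = refl

Cil↔Fin : ∀ N M → Cil N M ↔ Fin (cilClosed N M)
Cil↔Fin zero zero = mk↔ₛ′ (λ _ → zero) (λ _ → mkCil 0 0 refl empty empty (⊑⇒≼ empty empty (λ ())))
  (λ { zero → refl })
  (λ { (mkCil _ _ _ (mkΓ [] _) (mkΓ [] _) _) → refl
     ; (mkCil _ _ _ (mkΓ (() ∷ _) _) _ _)
     ; (mkCil _ _ _ _ (mkΓ (() ∷ _) _) _) })
Cil↔Fin zero (suc M) = subst (λ n → Cil 0 (suc M) ↔ Fin n) (sym (cilClosed-zero-suc M))
  (mk↔ₛ′ Cil-zero-suc-empty (λ ()) (λ ()) (λ c → Cil-zero-suc-empty c))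
  where
  Cil-zero-suc-empty : ∀ {A : Set} → Cil 0 (suc M) → A
  Cil-zero-suc-empty (mkCil _ _ s (mkΓ [] _) (mkΓ [] _) _) = ⊥-elim-irr (0≢1+n s)
  Cil-zero-suc-empty (mkCil _ _ _ (mkΓ (() ∷ _) _) _ _)
  Cil-zero-suc-empty (mkCil _ _ _ _ (mkΓ (() ∷ _) _) _)
Cil↔Fin (suc N) M = begin
  Cil (suc N) M
    ↔⟨ Cil-suc↔SplitCil ⟩
  SplitCil N M
    ↔⟨ SplitCil↔⊎ ⟩
  (Cil N M ⊎ Below (Cil N) M ⊎ Below (Γ₊ N) M ⊎ Below (Below (Γ₊ N)) M)
    ↔⟨ Cil↔Fin N M ⊎-↔Fin below-↔ (Cil↔Fin N) M ⊎-↔Fin below-↔ (Γ₊↔Fin N) M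
                     ⊎-↔Fin below-↔ (below-↔ (Γ₊↔Fin N)) M ⟩
  Fin (cilClosed N M + (below (cilClosed N) M + (below (N C_) M + below (below (N C_)) M)))
    ≡⟨ cong Fin (sym (cilClosed-suc N M)) ⟩
  Fin (cilClosed (suc N) M) ∎
  where open EquationalReasoning

mainTheorem9 : (N M : ℕ) → Cil N M ↔ Fin (cil N M)
mainTheorem9 N M = subst (λ n → Cil N M ↔ Fin n) (sym (cil≡cilClosed N M)) (Cil↔Fin N M)
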